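{- Let $G=(V,A)$ be an Eulerian digraph, $s_1\neq s_2$ vertices of $G$, and $\mathcal{C}_1$ the set of recurrent configurations of the chip-firing game on $G$ with sink $s_1$. For every $c\in\mathcal{C}_1$ and $i\in\mathbb{N}$, $\left(\left(\overline{c}^{\,i}\right)^{\circ s_2}\right)^{\circ s_1}=\overline{c}^{\,i}$.
   Context: All digraphs are finite multi-digraphs without loops; $\deg_G(u,w)$ is the number of arcs from $u$ to $w$, $\deg^\pm_G$ out/in-degree. $G$ is Eulerian if connected and $\deg^-_G(v)=\deg^+_G(v)$ for all $v$. Chip-firing game with sink $s$: configurations are maps $c:V\setminus\{s\}\to\mathbb{N}$; $v\neq s$ is firable if $c(v)\ge\deg^+_G(v)$; firing $v$ decreases $c(v)$ by $\deg^+_G(v)$ and increases $c(w)$ by $\deg_G(v,w)$ for $w\notin\{v,s\}$; $s$ never fires. Repeated firing gives a unique stable configuration $c^\circ$. A stable $c$ is recurrent if for every configuration $d$ there is a configuration $d'$ with $(d+d')^\circ=c$. For a map $x:V\to\mathbb{N}$ and a vertex $s$, $x^{\circ s}:V\to\mathbb{N}$ is obtained by repeatedly firing vertices $v\ne s$ with $x(v)\ge\deg^+_G(v)$, where firing $v$ decreases $x(v)$ by $\deg^+_G(v)$ and increases $x(w)$ by $\deg_G(v,w)$ for every $w\ne v$ (including $w=s$; chips on $s$ are kept), until no vertex other than $s$ is firable; this is well defined. For a configuration $c:V\setminus\{s_1\}\to\mathbb{N}$ and $i\in\mathbb{N}$, $\overline{c}^{\,i}:V\to\mathbb{N}$ equals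 $c$ on $V\setminus\{s_1\}$ and $\deg^+_G(s_1)+i$ at $s_1$. -}

module Defs where

open import Data.Nat using (ℕ; _+_; _∸_; _≤_; _<_)
open import Data.Fin using (Fin; _≟_)
open import Data.List using (map; allFin)
open import Data.Nat.ListAction using (sum)
open import Data.Product using (Σ; ∃; _×_)
open import Data.Sum using (_⊎_)
open import Relation.Nullary using (¬_; yes; no)
open import Relation.Binary.PropositionalEquality using (_≡_; _≢_)
open import Relation.Binary.Construct.Closure.ReflexiveTransitive using (Star)

record Digraph : Set where
  field
    n        : ℕ
    deg      : Fin n → Fin n → ℕ
    loopless : ∀ v → deg v v ≡ 0
open Digraph public

module _ (G : Digraph) where

  V : Set
  V = Fin (n G)

  outdeg : V → ℕ
  outdeg v = sum (map (λ w → deg G v w) (allFin (n G)))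

  indeg : V → ℕ
  indeg v = sum (map (λ u → deg G u v) (allFin (n G)))

  Adj : V → V → Set
  Adj u w = (0 < deg G u w) ⊎ (0 < deg G w u)

  Connected : Set
  Connected = ∀ u w → Star Adj u w

  Eulerian : Set
  Eulerian = Connected × (∀ v → indeg v ≡ outdeg v)

  fire : (V → ℕ) → V → (V → ℕ)
  fire x v w with w ≟ v
  ... | yes _ = x v ∸ outdeg v
  ... | no  _ = x w + deg G v w

  Fire : V → (V → ℕ) → (V → ℕ) → Set
  Fire s x y = ∃ λ v → (v ≢ s) × (outdeg v ≤ x v) × (∀ w → y w ≡ fire x v w)

  Stable : V → (V → ℕ) → Set
  Stable s x = ∀ v → v ≢ s → x v < outdeg v

  -- Stab s x y : y is obtained from x by repeatedly firing vertices ≠ s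
  -- until no vertex other than s is firable, i.e. y = x^{∘ s}.
  Stab : V → (V → ℕ) → (V → ℕ) → Set
  Stab s x y = Star (Fire s) x y × Stable s y

  -- Configurations of the game with sink s are maps V \ {s} → ℕ; we model them
  -- as maps V → ℕ whose value at s is irrelevant (it never influences the
  -- dynamics on V \ {s}); equality of configurations is agreement off s.
  AgreeOff : V → (V → ℕ) → (V → ℕ) → Set
  AgreeOff s c d = ∀ v → v ≢ s → c v ≡ d v

  _⊕_ : (V → ℕ) → (V → ℕ) → (V → ℕ)
  (c ⊕ d) v = c v + d v

  Recurrent : V → (V → ℕ) → Set
  Recurrent s c = Stable s c ×
    (∀ (d : V → ℕ) → ∃ λ (d' : V → ℕ) → ∃ λ (e : V → ℕ) →
        Stab s (d ⊕ d') e × AgreeOff s e c)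

  -- \overline{c}^i : equal to c off s₁ and outdeg s₁ + i at s₁
  bar : V → (V → ℕ) → ℕ → (V → ℕ)
  bar s₁ c i v with v ≟ s₁
  ... | yes _ = outdeg s₁ + i
  ... | no  _ = c v

module Submission where

-- Concatenate a stabilisation for sink s₂ with one for sink s₁ and let F(v) count how often v
-- fires in total.  Chips are conserved, and every vertex w satisfies the balance
--   final(w) + outdeg(w)·F(w) = initial(w) + Σᵤ F(u)·deg(u,w).
-- If the vertices firing most often did not include s₁, the first of them to stop firing would
-- afterwards receive a chip from every other one, so by the balance it held at least outdeg chips
-- at the start, against the stability of c̄ⁱ off s₁.  Dually, if the vertices firing least often
-- did not include s₁, the recurrent c (which has no forbidden subconfiguration) forces one of them
-- to end with at least outdeg chips, against the stability of the result off s₁.  So F is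
-- constant, and on an Eulerian digraph firing every vertex equally often changes nothing.
-- Both stabilisations exist since an Eulerian digraph is strongly connected: along an arc w → u,
-- u receives chips whenever w fires but never holds more than all of them, which bounds the
-- firings along every path to the sink, and the sink never fires.

open import Defs

open import Data.Bool using (if_then_else_)
open import Data.Fin using (Fin; zero; suc; _≟_)
open import Data.Fin.Properties using (any?; all?; ¬∀⟶∃¬)
open import Data.List using (map; allFin; tabulate)
open import Data.List.Extrema.Nat using (argmax; argmin; f[xs]≤f[argmax]; f[argmin]≤f[xs])
open import Data.List.Membership.Propositional.Properties using (∈-allFin)
open import Data.List.Properties using (map-tabulate)
import Data.List.Relation.Unary.All as All
open import Data.Nat using (ℕ; zero; suc; _+_; _*_; _≤_; _<_; z≤n; s≤s; _≤?_; _<?_)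
import Data.Nat.ListAction as List
open import Data.Nat.Properties hiding (_≟_)
import Data.Nat.Properties as ℕ
open import Data.Nat.Tactic.RingSolver using (solve-∀)
open import Algebra.Properties.Semiring.Sum ℕ.+-*-semiring
  using (sum; sum-syntax; sum-cong-≗; sum-replicate-zero; ∑-distrib-+; ∑-comm; *-distribˡ-sum)
open import Data.Product using (∃; Σ; _×_; _,_; proj₁; proj₂)
open import Data.Sum as Sum using (_⊎_; inj₁; inj₂)
open import Function using (_∘_; id)
open import Level using (Level; 0ℓ)
open import Relation.Binary.Construct.Closure.ReflexiveTransitive as Star
  using (Star; ε; _◅_; _◅◅_)
open import Relation.Binary.PropositionalEquality
  using (_≡_; _≢_; refl; sym; trans; cong; cong₂; subst; subst₂; module ≡-Reasoning)
open import Relation.Nullary using (¬_; ¬?; Dec; does; yes; no; contradiction)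
open import Relation.Nullary.Decidable
  using (dec-true; dec-false; _×-dec_; _⊎-dec_; decidable-stable)
open import Relation.Unary using (Pred; Decidable)
open import Relation.Unary.Properties using (∁?)

private
  variable
    ℓ : Level
    A : Set ℓ
    m : ℕ

-- Indicators and finite sums

χ : Dec A → ℕ
χ a? = if does a? then 1 else 0

χ-yes : (a? : Dec A) → A → χ a? ≡ 1
χ-yes a? a rewrite dec-true a? a = refl

χ-no : (a? : Dec A) → ¬ A → χ a? ≡ 0
χ-no a? ¬a rewrite dec-false a? ¬a = refl

χ≤1 : (a? : Dec A) → χ a? ≤ 1
χ≤1 (yes _) = s≤s z≤n
χ≤1 (no _)  = z≤n

χ-mono : ∀ {b} {B : Set b} (a? : Dec A) (b? : Dec B) → (A → B) → χ a? ≤ χ b?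
χ-mono (yes a) b? A⇒B = ≤-reflexive (sym (χ-yes b? (A⇒B a)))
χ-mono (no _)  b? A⇒B = z≤n

χ-pos : (a? : Dec A) → 0 < χ a? → A
χ-pos (yes a) _ = a

χ+χ¬ : (a? : Dec A) → χ a? + χ (¬? a?) ≡ 1
χ+χ¬ (yes _) = refl
χ+χ¬ (no _)  = refl

sum-allFin : (f : Fin m → ℕ) → List.sum (map f (allFin m)) ≡ sum f
sum-allFin {m} f = trans (cong List.sum (map-tabulate id f)) (sum-tabulate f)
  where
  sum-tabulate : ∀ {m} (f : Fin m → ℕ) → List.sum (tabulate f) ≡ sum f
  sum-tabulate {zero}  f = refl
  sum-tabulate {suc m} f = cong (f zero +_) (sum-tabulate (f ∘ suc))

∑-mono-≤ : {f g : Fin m → ℕ} → (∀ i → f i ≤ g i) → sum f ≤ sum g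
∑-mono-≤ {zero}  f≤g = z≤n
∑-mono-≤ {suc m} f≤g = +-mono-≤ (f≤g zero) (∑-mono-≤ (f≤g ∘ suc))

∑-mono-< : {f g : Fin m → ℕ} → (∀ i → f i ≤ g i) → ∀ j → f j < g j → sum f < sum g
∑-mono-< f≤g zero    fj<gj = +-mono-<-≤ fj<gj (∑-mono-≤ (f≤g ∘ suc))
∑-mono-< f≤g (suc j) fj<gj = +-mono-≤-< (f≤g zero) (∑-mono-< (f≤g ∘ suc) j fj<gj)

term≤∑ : (f : Fin m → ℕ) (i : Fin m) → f i ≤ sum f
term≤∑ f zero    = m≤m+n _ _
term≤∑ f (suc i) = ≤-trans (term≤∑ (f ∘ suc) i) (m≤n+m _ _)

∑-pos : (f : Fin m → ℕ) → 0 < sum f → ∃ λ i → 0 < f i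
∑-pos {suc m} f ∑f>0 with f zero in eq
... | suc _ = zero , subst (0 <_) (sym eq) (s≤s z≤n)
... | zero with ∑-pos (f ∘ suc) ∑f>0
...   | i , fi>0 = suc i , fi>0

∑-one : ∑[ i < m ] 1 ≡ m
∑-one {zero}  = refl
∑-one {suc m} = cong suc (∑-one {m})

∑-pick : (v : Fin m) (g : Fin m → ℕ) → ∑[ u < m ] (χ (v ≟ u) * g u) ≡ g v
∑-pick {suc m} zero    g =
  trans (cong (g zero + 0 +_) (sum-replicate-zero m)) (trans (+-identityʳ _) (+-identityʳ _))
∑-pick {suc m} (suc v) g = ∑-pick v (g ∘ suc)

∑-χ≟ : (v : Fin m) → ∑[ u < m ] χ (v ≟ u) ≡ 1
∑-χ≟ v = trans (sum-cong-≗ (λ u → sym (*-identityʳ (χ (v ≟ u))))) (∑-pick v (λ _ → 1))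

argmax-max : (F : Fin m → ℕ) (i : Fin m) → ∀ u → F u ≤ F (argmax F i (allFin m))
argmax-max {m} F i u = All.lookup (f[xs]≤f[argmax] i (allFin m)) (∈-allFin u)

argmin-min : (F : Fin m → ℕ) (i : Fin m) → ∀ u → F (argmin F i (allFin m)) ≤ F u
argmin-min {m} F i u = All.lookup (f[argmin]≤f[xs] i (allFin m)) (∈-allFin u)

∑∈ : {P : Pred (Fin m) ℓ} → Decidable P → (Fin m → ℕ) → ℕ
∑∈ {m} P? f = ∑[ i < m ] (χ (P? i) * f i)

infixl 10 ∑∈
syntax ∑∈ P? (λ i → x) = ∑[ i ∈ P? ] x

module _ {P : Pred (Fin m) ℓ} (P? : Decidable P) where

  ∑-split : (f : Fin m → ℕ) → sum f ≡ ∑∈ P? f + ∑∈ (∁? P?) f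
  ∑-split f = trans (sum-cong-≗ split)
                    (∑-distrib-+ (λ i → χ (P? i) * f i) (λ i → χ (∁? P? i) * f i))
    where
    split : ∀ i → f i ≡ χ (P? i) * f i + χ (∁? P? i) * f i
    split i = begin
      f i                                 ≡⟨ sym (*-identityˡ (f i)) ⟩
      1 * f i                             ≡⟨ cong (_* f i) (sym (χ+χ¬ (P? i))) ⟩
      (χ (P? i) + χ (∁? P? i)) * f i      ≡⟨ *-distribʳ-+ (f i) (χ (P? i)) (χ (∁? P? i)) ⟩
      χ (P? i) * f i + χ (∁? P? i) * f i  ∎
      where open ≡-Reasoning

  term≤∑∈ : (f : Fin m → ℕ) {i : Fin m} → P i → f i ≤ ∑∈ P? f
  term≤∑∈ f {i} Pi =
    subst (_≤ ∑∈ P? f) (trans (cong (_* f i) (χ-yes (P? i) Pi)) (*-identityˡ (f i)))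
          (term≤∑ (λ j → χ (P? j) * f j) i)

  ∑∈-cong : {f g : Fin m → ℕ} → (∀ i → f i ≡ g i) → ∑∈ P? f ≡ ∑∈ P? g
  ∑∈-cong f≗g = sum-cong-≗ (λ i → cong (χ (P? i) *_) (f≗g i))

  ∑∈-distrib-+ : (f g : Fin m → ℕ) → ∑[ i ∈ P? ] (f i + g i) ≡ ∑∈ P? f + ∑∈ P? g
  ∑∈-distrib-+ f g = trans (sum-cong-≗ (λ i → *-distribˡ-+ (χ (P? i)) (f i) (g i)))
                           (∑-distrib-+ (λ i → χ (P? i) * f i) (λ i → χ (P? i) * g i))

  ∑∈-comm : (f : Fin m → Fin m → ℕ) →
            ∑[ i ∈ P? ] ∑[ j ∈ P? ] f i j ≡ ∑[ i ∈ P? ] ∑[ j ∈ P? ] f j i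
  ∑∈-comm f = begin
    ∑[ i < m ] (χ (P? i) * ∑[ j < m ] (χ (P? j) * f i j))
      ≡⟨ sum-cong-≗ (λ i → *-distribˡ-sum (χ (P? i)) (λ j → χ (P? j) * f i j)) ⟩
    ∑[ i < m ] ∑[ j < m ] (χ (P? i) * (χ (P? j) * f i j))
      ≡⟨ ∑-comm (λ i j → χ (P? i) * (χ (P? j) * f i j)) ⟩
    ∑[ j < m ] ∑[ i < m ] (χ (P? i) * (χ (P? j) * f i j))
      ≡⟨ sum-cong-≗ (λ j → sum-cong-≗ (λ i → swap (χ (P? i)) (χ (P? j)) (f i j))) ⟩
    ∑[ j < m ] ∑[ i < m ] (χ (P? j) * (χ (P? i) * f i j))
      ≡⟨ sum-cong-≗ (λ j → sym (*-distribˡ-sum (χ (P? j)) (λ i → χ (P? i) * f i j))) ⟩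
    ∑[ j < m ] (χ (P? j) * ∑[ i < m ] (χ (P? i) * f i j))
      ∎
    where
    open ≡-Reasoning
    swap : ∀ a b c → a * (b * c) ≡ b * (a * c)
    swap = solve-∀

  ∑∈-pos : (f : Fin m → ℕ) → 0 < ∑∈ P? f → ∃ λ i → P i × 0 < f i
  ∑∈-pos f pos with ∑-pos _ pos
  ... | i , χf>0 with P? i
  ...   | yes Pi = i , Pi , subst (0 <_) (+-identityʳ (f i)) χf>0
  ...   | no _   = contradiction χf>0 (λ ())

∑-below-max : (F d : Fin m → ℕ) {M : ℕ} → (∀ u → F u ≤ M) →
              ∑[ u < m ] (F u * d u) + sum d ≤ M * sum d + ∑[ u ∈ (λ u → M ≤? F u) ] d u
∑-below-max {m} F d {M} F≤M = begin
  ∑[ u < m ] (F u * d u) + sum d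
    ≡⟨ sym (∑-distrib-+ (λ u → F u * d u) d) ⟩
  ∑[ u < m ] (F u * d u + d u)
    ≤⟨ ∑-mono-≤ (λ u → pointwise u (M ≤? F u)) ⟩
  ∑[ u < m ] (M * d u + χ (M ≤? F u) * d u)
    ≡⟨ ∑-distrib-+ (λ u → M * d u) (λ u → χ (M ≤? F u) * d u) ⟩
  ∑[ u < m ] (M * d u) + ∑[ u ∈ (λ u → M ≤? F u) ] d u
    ≡⟨ cong (_+ ∑[ u ∈ (λ u → M ≤? F u) ] d u) (sym (*-distribˡ-sum M d)) ⟩
  M * sum d + ∑[ u ∈ (λ u → M ≤? F u) ] d u
    ∎
  where
  open ≤-Reasoning
  pointwise : ∀ u (M≤?Fu : Dec (M ≤ F u)) → F u * d u + d u ≤ M * d u + χ M≤?Fu * d u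
  pointwise u (yes M≤Fu) rewrite ≤-antisym (F≤M u) M≤Fu | +-identityʳ (d u) = ≤-refl
  pointwise u (no M≰Fu) rewrite +-identityʳ (M * d u) | +-comm (F u * d u) (d u) =
    *-monoˡ-≤ (d u) (≰⇒> M≰Fu)

∑-above-min : (F d : Fin m → ℕ) {M : ℕ} → (∀ u → M ≤ F u) →
              M * sum d + sum d ≤ ∑[ u < m ] (F u * d u) + ∑[ u ∈ (λ u → F u ≤? M) ] d u
∑-above-min {m} F d {M} M≤F = begin
  M * sum d + sum d
    ≡⟨ cong (_+ sum d) (*-distribˡ-sum M d) ⟩
  ∑[ u < m ] (M * d u) + sum d
    ≡⟨ sym (∑-distrib-+ (λ u → M * d u) d) ⟩
  ∑[ u < m ] (M * d u + d u)
    ≤⟨ ∑-mono-≤ (λ u → pointwise u (F u ≤? M)) ⟩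
  ∑[ u < m ] (F u * d u + χ (F u ≤? M) * d u)
    ≡⟨ ∑-distrib-+ (λ u → F u * d u) (λ u → χ (F u ≤? M) * d u) ⟩
  ∑[ u < m ] (F u * d u) + ∑[ u ∈ (λ u → F u ≤? M) ] d u
    ∎
  where
  open ≤-Reasoning
  pointwise : ∀ u (Fu≤?M : Dec (F u ≤ M)) → M * d u + d u ≤ F u * d u + χ Fu≤?M * d u
  pointwise u (yes Fu≤M) rewrite ≤-antisym Fu≤M (M≤F u) | +-identityʳ (d u) = ≤-refl
  pointwise u (no Fu≰M) rewrite +-identityʳ (F u * d u) | +-comm (M * d u) (d u) =
    *-monoˡ-≤ (d u) (≰⇒> Fu≰M)

walk-crosses : ∀ {a r} {A : Set a} {R : A → A → Set r} {P : Pred A ℓ} → Decidable P →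
               ∀ {x y} → Star R x y → P x → ¬ P y → ∃ λ u → ∃ λ w → P u × ¬ P w × R u w
walk-crosses P? ε Px ¬Py = contradiction Px ¬Py
walk-crosses P? (_◅_ {j = w} r rs) Px ¬Py with P? w
... | yes Pw  = walk-crosses P? rs Pw ¬Py
... | no ¬Pw  = _ , w , Px , ¬Pw , r

-- Chip-firing on an arbitrary digraph

module _ (G : Digraph) where

  outdeg≡∑ : ∀ v → outdeg G v ≡ ∑[ w < n G ] deg G v w
  outdeg≡∑ v = sum-allFin (deg G v)

  indeg≡∑ : ∀ v → indeg G v ≡ ∑[ u < n G ] deg G u v
  indeg≡∑ v = sum-allFin (λ u → deg G u v)

  Arc : V G → V G → Set
  Arc u w = 0 < deg G u w

  inflow : (V G → ℕ) → V G → ℕ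
  inflow F w = ∑[ u < n G ] (F u * deg G u w)

  -- No vertex is a sink here, so that stabilisations for different sinks can be concatenated.
  Step : (V G → ℕ) → (V G → ℕ) → Set
  Step x y = ∃ λ v → outdeg G v ≤ x v × (∀ w → y w ≡ fire G x v w)

  firings : ∀ {x y} → Star Step x y → V G → ℕ
  firings ε             u = 0
  firings ((v , _) ◅ p) u = χ (v ≟ u) + firings p u

  forgetSink : ∀ {s x y} → Star (Fire G s) x y → Star Step x y
  forgetSink = Star.map (λ (v , _ , fireable , result) → v , fireable , result)

  sink-idle : ∀ {s x y} (p : Star (Fire G s) x y) → firings (forgetSink p) s ≡ 0
  sink-idle ε                       = refl
  sink-idle {s} ((v , v≢s , _) ◅ p) = cong₂ _+_ (χ-no (v ≟ s) v≢s) (sink-idle p)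

  fire-balance : ∀ x v w → outdeg G v ≤ x v →
                 fire G x v w + outdeg G w * χ (v ≟ w) ≡ x w + deg G v w
  fire-balance x v w fireable with w ≟ v
  ... | yes refl
    rewrite χ-yes (w ≟ w) refl | loopless G w | *-identityʳ (outdeg G w) | +-identityʳ (x w)
    = m∸n+n≡m fireable
  ... | no w≢v rewrite χ-no (v ≟ w) (w≢v ∘ sym) | *-zeroʳ (outdeg G w) = +-identityʳ _

  firing-balance : ∀ {x y} (p : Star Step x y) →
                   ∀ w → y w + outdeg G w * firings p w ≡ x w + inflow (firings p) w
  firing-balance {x} ε w =
    cong (x w +_) (trans (*-zeroʳ (outdeg G w)) (sym (sum-replicate-zero (n G))))
  firing-balance {x} {y} (_◅_ {j = x′} step@(v , fireable , result) p) w = begin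
    y w + od * (χ (v ≟ w) + F w)               ≡⟨ rearrange (y w) od (χ (v ≟ w)) (F w) ⟩
    y w + od * F w + od * χ (v ≟ w)            ≡⟨ cong (_+ od * χ (v ≟ w)) (firing-balance p w) ⟩
    x′ w + inflow F w + od * χ (v ≟ w)         ≡⟨ swap (x′ w) (inflow F w) (od * χ (v ≟ w)) ⟩
    x′ w + od * χ (v ≟ w) + inflow F w         ≡⟨ cong (λ k → k + od * χ (v ≟ w) + inflow F w)
                                                       (result w) ⟩
    fire G x v w + od * χ (v ≟ w) + inflow F w ≡⟨ cong (_+ inflow F w) (fire-balance x v w fireable) ⟩
    x w + deg G v w + inflow F w               ≡⟨ +-assoc (x w) (deg G v w) (inflow F w) ⟩
    x w + (deg G v w + inflow F w)             ≡⟨ cong (x w +_) inflow-step ⟩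
    x w + inflow (firings (step ◅ p)) w        ∎
    where
    open ≡-Reasoning
    od = outdeg G w
    F = firings p
    rearrange : ∀ a b c d → a + b * (c + d) ≡ a + b * d + b * c
    rearrange = solve-∀
    swap : ∀ a b c → a + b + c ≡ a + c + b
    swap = solve-∀
    inflow-step : deg G v w + inflow F w ≡ ∑[ u < n G ] ((χ (v ≟ u) + F u) * deg G u w)
    inflow-step = begin
      deg G v w + inflow F w
        ≡⟨ cong (_+ inflow F w) (sym (∑-pick v (λ u → deg G u w))) ⟩
      ∑[ u < n G ] (χ (v ≟ u) * deg G u w) + inflow F w
        ≡⟨ sym (∑-distrib-+ (λ u → χ (v ≟ u) * deg G u w) (λ u → F u * deg G u w)) ⟩
      ∑[ u < n G ] (χ (v ≟ u) * deg G u w + F u * deg G u w)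
        ≡⟨ sum-cong-≗ (λ u → sym (*-distribʳ-+ (deg G u w) (χ (v ≟ u)) (F u))) ⟩
      ∑[ u < n G ] ((χ (v ≟ u) + F u) * deg G u w)
        ∎

  idle-balance : ∀ {x y} (p : Star Step x y) {w} → firings p w ≡ 0 →
                 y w ≡ x w + inflow (firings p) w
  idle-balance {x} {y} p {w} idle = begin
    y w                             ≡⟨ sym (+-identityʳ (y w)) ⟩
    y w + 0                         ≡⟨ cong (y w +_) (sym (*-zeroʳ (outdeg G w))) ⟩
    y w + outdeg G w * 0            ≡⟨ cong (λ k → y w + outdeg G w * k) (sym idle) ⟩
    y w + outdeg G w * firings p w  ≡⟨ firing-balance p w ⟩
    x w + inflow (firings p) w      ∎
    where open ≡-Reasoning

  unstable⇒fires : ∀ {x y} (p : Star Step x y) {u} →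
                   outdeg G u ≤ x u → y u < outdeg G u → 0 < firings p u
  unstable⇒fires p unstable stable = n≢0⇒n>0 λ idle →
    <⇒≱ stable (≤-trans unstable (≤-trans (m≤m+n _ _) (≤-reflexive (sym (idle-balance p idle)))))

  firing-conserves : ∀ {x y} (p : Star Step x y) → sum y ≡ sum x
  firing-conserves {x} {y} p = +-cancelʳ-≡ spent (sum y) (sum x) (begin
    sum y + spent
      ≡⟨ cong (sum y +_) (sum-cong-≗ λ w → *-comm (F w) (outdeg G w)) ⟩
    sum y + ∑[ w < n G ] (outdeg G w * F w)
      ≡⟨ sym (∑-distrib-+ y (λ w → outdeg G w * F w)) ⟩
    ∑[ w < n G ] (y w + outdeg G w * F w)
      ≡⟨ sum-cong-≗ (firing-balance p) ⟩
    ∑[ w < n G ] (x w + inflow F w)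
      ≡⟨ ∑-distrib-+ x (inflow F) ⟩
    sum x + ∑[ w < n G ] ∑[ u < n G ] (F u * deg G u w)
      ≡⟨ cong (sum x +_) (∑-comm (λ w u → F u * deg G u w)) ⟩
    sum x + ∑[ u < n G ] ∑[ w < n G ] (F u * deg G u w)
      ≡⟨ cong (sum x +_) (sum-cong-≗ spentBy) ⟩
    sum x + spent
      ∎)
    where
    open ≡-Reasoning
    F = firings p
    spent = ∑[ u < n G ] (F u * outdeg G u)
    spentBy : ∀ u → ∑[ w < n G ] (F u * deg G u w) ≡ F u * outdeg G u
    spentBy u = trans (sym (*-distribˡ-sum (F u) (deg G u))) (cong (F u *_) (sym (outdeg≡∑ u)))

  -- Constructive negation of "T is a forbidden subconfiguration of c".
  NotForbidden : {T : Pred (V G) 0ℓ} → Decidable T → (V G → ℕ) → Set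
  NotForbidden {T} T? c = ∃ λ v → T v × ∑[ u ∈ T? ] deg G u v ≤ c v

  ForbiddenFree : V G → (V G → ℕ) → Set₁
  ForbiddenFree s c = ∀ {T : Pred (V G) 0ℓ} (T? : Decidable T) {v₀} → T v₀ →
                      (∀ u → T u → u ≢ s) → NotForbidden T? c

  -- The witness is the first vertex of T to fire for the last time.
  allFired⇒notForbidden : ∀ {x z} (p : Star Step x z) {T : Pred (V G) 0ℓ} (T? : Decidable T) {v₀} →
                          T v₀ → (∀ u → T u → 0 < firings p u) → NotForbidden T? z
  allFired⇒notForbidden ε T? Tv₀ fired = contradiction (fired _ Tv₀) (λ ())
  allFired⇒notForbidden {z = z} (_◅_ {j = y} (w , _) p) {T} T? Tv₀ fired
    with any? (λ u → T? u ×-dec (firings p u ℕ.≟ 0))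
  ... | no noneIdle =
    allFired⇒notForbidden p T? Tv₀ λ u Tu → n≢0⇒n>0 λ idle → noneIdle (u , Tu , idle)
  ... | yes (u , Tu , idle) = w , subst T u≡w Tu , bound
    where
    u≡w : u ≡ w
    u≡w = sym (χ-pos (w ≟ u)
            (subst (0 <_) (trans (cong (χ (w ≟ u) +_) idle) (+-identityʳ _)) (fired u Tu)))
    pointwise : ∀ u′ → χ (T? u′) * deg G u′ w ≤ firings p u′ * deg G u′ w
    pointwise u′ with T? u′ | u′ ≟ w
    ... | no _    | _        = z≤n
    ... | yes _   | yes refl rewrite loopless G u′ = z≤n
    ... | yes Tu′ | no u′≢w  = *-monoˡ-≤ (deg G u′ w)
          (subst (0 <_) (cong (_+ firings p u′) (χ-no (w ≟ u′) (u′≢w ∘ sym))) (fired u′ Tu′))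
    bound : ∑[ u ∈ T? ] deg G u w ≤ z w
    bound = begin
      ∑[ u ∈ T? ] deg G u w       ≤⟨ ∑-mono-≤ pointwise ⟩
      inflow (firings p) w        ≤⟨ m≤n+m _ _ ⟩
      y w + inflow (firings p) w  ≡⟨ sym (idle-balance p (subst (λ k → firings p k ≡ 0) u≡w idle)) ⟩
      z w                         ∎
      where open ≤-Reasoning

  -- Adding outdeg chips everywhere and stabilising back to c makes every vertex but s fire.
  recurrent⇒forbiddenFree : ∀ {s c} → Recurrent G s c → ForbiddenFree s c
  recurrent⇒forbiddenFree (_ , reaches) T? Tv₀ T∌s
    with d′ , e , (q , e-stable) , e≈c ← reaches (outdeg G)
    with v , Tv , inflow≤e ← allFired⇒notForbidden (forgetSink q) T? Tv₀ (λ u Tu →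
           unstable⇒fires (forgetSink q) (m≤m+n _ (d′ u)) (e-stable u (T∌s u Tu)))
    = v , Tv , subst (_ ≤_) (e≈c v (T∌s v Tv)) inflow≤e

  firings-along-arc : ∀ {x y} (p : Star Step x y) {w u} → Arc w u →
                      firings p w ≤ sum x + outdeg G u * firings p u
  firings-along-arc {x} {y} p {w} {u} arc = begin
    F w                       ≡⟨ sym (*-identityʳ (F w)) ⟩
    F w * 1                   ≤⟨ *-monoʳ-≤ (F w) arc ⟩
    F w * deg G w u           ≤⟨ term≤∑ (λ w′ → F w′ * deg G w′ u) w ⟩
    inflow F u                ≤⟨ m≤n+m _ (x u) ⟩
    x u + inflow F u          ≡⟨ sym (firing-balance p u) ⟩
    y u + outdeg G u * F u    ≤⟨ +-monoˡ-≤ _ (≤-trans (term≤∑ y u) (≤-reflexive (firing-conserves p))) ⟩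
    sum x + outdeg G u * F u  ∎
    where
    open ≤-Reasoning
    F = firings p

  pathFiringBound : ℕ → ∀ {v s} → Star Arc v s → ℕ
  pathFiringBound N ε                    = 0
  pathFiringBound N (_◅_ {j = u} _ path) = N + outdeg G u * pathFiringBound N path

  firings≤pathFiringBound : ∀ {s x y} (p : Star (Fire G s) x y) {v} (path : Star Arc v s) →
                            firings (forgetSink p) v ≤ pathFiringBound (sum x) path
  firings≤pathFiringBound p ε = ≤-reflexive (sink-idle p)
  firings≤pathFiringBound {x = x} p (_◅_ {j = u} arc path) =
    ≤-trans (firings-along-arc (forgetSink p) arc)
            (+-monoʳ-≤ (sum x) (*-monoʳ-≤ (outdeg G u) (firings≤pathFiringBound p path)))

  stabilizes-or-fires : ∀ s k x →
    (∃ λ y → Stab G s x y) ⊎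
    (∃ λ y → Σ (Star (Fire G s) x y) λ p → k ≤ sum (firings (forgetSink p)))
  stabilizes-or-fires s zero x = inj₂ (x , ε , z≤n)
  stabilizes-or-fires s (suc k) x with any? (λ v → ¬? (v ≟ s) ×-dec (outdeg G v ≤? x v))
  ... | no noneFirable = inj₁ (x , ε , λ v v≢s → ≰⇒> λ firable → noneFirable (v , v≢s , firable))
  ... | yes (v , v≢s , firable) =
    Sum.map (λ (y , q , y-stable) → y , step ◅ q , y-stable)
            (λ (y , q , k≤) → y , step ◅ q , subst (suc k ≤_) (sym (one-more q)) (s≤s k≤))
            (stabilizes-or-fires s k (fire G x v))
    where
    step : Fire G s x (fire G x v)
    step = v , v≢s , firable , λ w → refl
    one-more : ∀ {y} (q : Star (Fire G s) (fire G x v) y) →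
               sum (firings (forgetSink (step ◅ q))) ≡ suc (sum (firings (forgetSink q)))
    one-more q = trans (∑-distrib-+ (λ u → χ (v ≟ u)) (firings (forgetSink q)))
                       (cong (_+ sum (firings (forgetSink q))) (∑-χ≟ v))

-- Eulerian digraphs

module _ (G : Digraph) (eulerian : Eulerian G) where

  ∑in≡outdeg : ∀ v → ∑[ u < n G ] deg G u v ≡ outdeg G v
  ∑in≡outdeg v = trans (sym (indeg≡∑ G v)) (proj₂ eulerian v)

  stable⇒sinkFiresMost : ∀ {s x z} → Stable G s x → (p : Star (Step G) x z) →
                         ∀ u → firings G p u ≤ firings G p s
  stable⇒sinkFiresMost {s} {x} {z} x-stable p u = ≤-trans (argmax-max F s u) (≮⇒≥ sinkBelowMax)
    where
    F = firings G p
    top = argmax F s (allFin (n G))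
    M = F top
    T? : Decidable (λ u → M ≤ F u)
    T? u = M ≤? F u
    sinkBelowMax : ¬ F s < M
    sinkBelowMax Fs<M
      with allFired⇒notForbidden G p T? {top} ≤-refl
             (λ u M≤Fu → <-≤-trans (≤-<-trans z≤n Fs<M) M≤Fu)
    ... | v , M≤Fv , inflowT≤z = <⇒≱ (x-stable v v≢s) (cancel balance below inflowT≤z)
      where
      v≢s : v ≢ s
      v≢s refl = <⇒≱ Fs<M M≤Fv
      balance : z v + outdeg G v * M ≡ x v + inflow G F v
      balance = subst (λ k → z v + outdeg G v * k ≡ x v + inflow G F v)
                      (≤-antisym (argmax-max F s v) M≤Fv) (firing-balance G p v)
      below : inflow G F v + outdeg G v ≤ M * outdeg G v + ∑[ u ∈ T? ] deg G u v
      below = subst (λ o → inflow G F v + o ≤ M * o + ∑[ u ∈ T? ] deg G u v) (∑in≡outdeg v)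
                    (∑-below-max F (λ u → deg G u v) (argmax-max F s))
      cancel : ∀ {z o M x S X} → z + o * M ≡ x + S → S + o ≤ M * o + X → X ≤ z → o ≤ x
      cancel {z} {o} {M} {x} {S} {X} balance below X≤z = +-cancelˡ-≤ (z + o * M) o x (begin
        z + o * M + o    ≡⟨ cong (_+ o) balance ⟩
        x + S + o        ≡⟨ +-assoc x S o ⟩
        x + (S + o)      ≤⟨ +-monoʳ-≤ x below ⟩
        x + (M * o + X)  ≤⟨ +-monoʳ-≤ x (+-monoʳ-≤ (M * o) X≤z) ⟩
        x + (M * o + z)  ≡⟨ shuffle x M o z ⟩
        z + o * M + x    ∎)
        where
        open ≤-Reasoning
        shuffle : ∀ x M o z → x + (M * o + z) ≡ z + o * M + x
        shuffle = solve-∀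

  forbiddenFree⇒sinkFiresLeast : ∀ {s c x z} → ForbiddenFree G s c → AgreeOff G s x c →
                                 Stable G s z → (p : Star (Step G) x z) →
                                 ∀ u → firings G p s ≤ firings G p u
  forbiddenFree⇒sinkFiresLeast {s} {c} {x} {z} forbiddenFree x≈c z-stable p u =
    ≤-trans (≮⇒≥ sinkAboveMin) (argmin-min F s u)
    where
    F = firings G p
    bot = argmin F s (allFin (n G))
    M = F bot
    T? : Decidable (λ u → F u ≤ M)
    T? u = F u ≤? M
    sinkAboveMin : ¬ M < F s
    sinkAboveMin M<Fs
      with forbiddenFree T? {bot} ≤-refl
             (λ u Fu≤M u≡s → <⇒≱ M<Fs (subst (λ k → F k ≤ M) u≡s Fu≤M))
    ... | v , Fv≤M , inflowT≤c =
      <⇒≱ (z-stable v v≢s) (cancel balance above (subst (_ ≤_) (sym (x≈c v v≢s)) inflowT≤c))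
      where
      v≢s : v ≢ s
      v≢s refl = <⇒≱ M<Fs Fv≤M
      balance : z v + outdeg G v * M ≡ x v + inflow G F v
      balance = subst (λ k → z v + outdeg G v * k ≡ x v + inflow G F v)
                      (≤-antisym Fv≤M (argmin-min F s v)) (firing-balance G p v)
      above : M * outdeg G v + outdeg G v ≤ inflow G F v + ∑[ u ∈ T? ] deg G u v
      above = subst (λ o → M * o + o ≤ inflow G F v + ∑[ u ∈ T? ] deg G u v) (∑in≡outdeg v)
                    (∑-above-min F (λ u → deg G u v) (argmin-min F s))
      cancel : ∀ {z o M x S X} → z + o * M ≡ x + S → M * o + o ≤ S + X → X ≤ x → o ≤ z
      cancel {z} {o} {M} {x} {S} {X} balance above X≤x = +-cancelˡ-≤ (x + M * o) o z (begin
        x + M * o + o    ≡⟨ +-assoc x (M * o) o ⟩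
        x + (M * o + o)  ≤⟨ +-monoʳ-≤ x above ⟩
        x + (S + X)      ≡⟨ sym (+-assoc x S X) ⟩
        x + S + X        ≡⟨ cong (_+ X) (sym balance) ⟩
        z + o * M + X    ≤⟨ +-monoʳ-≤ (z + o * M) X≤x ⟩
        z + o * M + x    ≡⟨ shuffle z o M x ⟩
        x + M * o + z    ∎)
        where
        open ≤-Reasoning
        shuffle : ∀ z o M x → z + o * M + x ≡ x + M * o + z
        shuffle = solve-∀

  uniformFirings⇒unchanged : ∀ {x z} (p : Star (Step G) x z) {K} →
                             (∀ u → firings G p u ≡ K) → ∀ v → z v ≡ x v
  uniformFirings⇒unchanged {x} {z} p {K} uniform v =
    +-cancelʳ-≡ (outdeg G v * K) (z v) (x v) (begin
      z v + outdeg G v * K                ≡⟨ cong (λ k → z v + outdeg G v * k) (sym (uniform v)) ⟩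
      z v + outdeg G v * firings G p v    ≡⟨ firing-balance G p v ⟩
      x v + inflow G (firings G p) v      ≡⟨ cong (x v +_) (sum-cong-≗ λ u → cong (_* deg G u v)
                                                                               (uniform u)) ⟩
      x v + ∑[ u < n G ] (K * deg G u v)  ≡⟨ cong (x v +_) (sym (*-distribˡ-sum K (λ u → deg G u v))) ⟩
      x v + K * ∑[ u < n G ] deg G u v    ≡⟨ cong (λ o → x v + K * o) (∑in≡outdeg v) ⟩
      x v + K * outdeg G v                ≡⟨ cong (x v +_) (*-comm K (outdeg G v)) ⟩
      x v + outdeg G v * K                ∎)
    where open ≡-Reasoning

  module _ {T : Pred (V G) 0ℓ} (T? : Decidable T) where

    cut-balance : ∑[ a ∈ T? ] ∑[ b ∈ ∁? T? ] deg G a b ≡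
                  ∑[ a ∈ T? ] ∑[ b ∈ ∁? T? ] deg G b a
    cut-balance = +-cancelˡ-≡ internal leaving entering (begin
      internal + leaving
        ≡⟨ sym (∑∈-distrib-+ T? (λ a → ∑[ b ∈ T? ] deg G a b) (λ a → ∑[ b ∈ ∁? T? ] deg G a b)) ⟩
      ∑[ a ∈ T? ] (∑[ b ∈ T? ] deg G a b + ∑[ b ∈ ∁? T? ] deg G a b)
        ≡⟨ ∑∈-cong T? (λ a → sym (∑-split T? (deg G a))) ⟩
      ∑[ a ∈ T? ] ∑[ b < n G ] deg G a b
        ≡⟨ ∑∈-cong T? (λ a → trans (sym (outdeg≡∑ G a)) (sym (∑in≡outdeg a))) ⟩
      ∑[ a ∈ T? ] ∑[ b < n G ] deg G b a
        ≡⟨ ∑∈-cong T? (λ a → ∑-split T? (λ b → deg G b a)) ⟩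
      ∑[ a ∈ T? ] (∑[ b ∈ T? ] deg G b a + ∑[ b ∈ ∁? T? ] deg G b a)
        ≡⟨ ∑∈-distrib-+ T? (λ a → ∑[ b ∈ T? ] deg G b a) (λ a → ∑[ b ∈ ∁? T? ] deg G b a) ⟩
      ∑[ a ∈ T? ] ∑[ b ∈ T? ] deg G b a + entering
        ≡⟨ cong (_+ entering) (sym (∑∈-comm T? (deg G))) ⟩
      internal + entering
        ∎)
      where
      open ≡-Reasoning
      internal = ∑[ a ∈ T? ] ∑[ b ∈ T? ] deg G a b
      leaving  = ∑[ a ∈ T? ] ∑[ b ∈ ∁? T? ] deg G a b
      entering = ∑[ a ∈ T? ] ∑[ b ∈ ∁? T? ] deg G b a

    term≤cut : ∀ {a b} (f : V G → V G → ℕ) → T a → ¬ T b →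
               f a b ≤ ∑[ a ∈ T? ] ∑[ b ∈ ∁? T? ] f a b
    term≤cut f Ta ¬Tb =
      ≤-trans (term≤∑∈ (∁? T?) (f _) ¬Tb) (term≤∑∈ T? (λ a → ∑[ b ∈ ∁? T? ] f a b) Ta)

    adjacent⇒cut>0 : ∀ {a b} → T a → ¬ T b → Adj G a b →
                     0 < ∑[ a ∈ T? ] ∑[ b ∈ ∁? T? ] deg G a b
    adjacent⇒cut>0 Ta ¬Tb (inj₁ a→b) = <-≤-trans a→b (term≤cut (deg G) Ta ¬Tb)
    adjacent⇒cut>0 Ta ¬Tb (inj₂ b→a) =
      subst (0 <_) (sym cut-balance) (<-≤-trans b→a (term≤cut (λ a b → deg G b a) Ta ¬Tb))

    arcLeaving : ∀ {v w} → T v → ¬ T w → ∃ λ a → ∃ λ b → T a × ¬ T b × Arc G a b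
    arcLeaving {v} {w} Tv ¬Tw
      with a , b , Ta , ¬Tb , a~b ← walk-crosses T? (proj₁ eulerian v w) Tv ¬Tw
      with a′ , Ta′ , leaving>0 ← ∑∈-pos T? _ (adjacent⇒cut>0 Ta ¬Tb a~b)
      with b′ , ¬Tb′ , arc ← ∑∈-pos (∁? T?) (deg G a′) leaving>0
      = a′ , b′ , Ta′ , ¬Tb′ , arc

  module _ (s : V G) where

    ReachesWithin : ℕ → V G → Set
    ReachesWithin zero    v = v ≡ s
    ReachesWithin (suc L) v = ReachesWithin L v ⊎ ∃ λ u → Arc G v u × ReachesWithin L u

    reachesWithin? : ∀ L → Decidable (ReachesWithin L)
    reachesWithin? zero    v = v ≟ s
    reachesWithin? (suc L) v =
      reachesWithin? L v ⊎-dec any? (λ u → (0 <? deg G v u) ×-dec reachesWithin? L u)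

    reachesWithin-sink : ∀ L → ReachesWithin L s
    reachesWithin-sink zero    = refl
    reachesWithin-sink (suc L) = inj₁ (reachesWithin-sink L)

    reachesWithin⇒path : ∀ L {v} → ReachesWithin L v → Star (Arc G) v s
    reachesWithin⇒path zero    refl                 = ε
    reachesWithin⇒path (suc L) (inj₁ r)             = reachesWithin⇒path L r
    reachesWithin⇒path (suc L) (inj₂ (u , arc , r)) = arc ◅ reachesWithin⇒path L r

    #reachingWithin : ℕ → ℕ
    #reachingWithin L = ∑[ v < n G ] χ (reachesWithin? L v)

    -- Unless every vertex reaches s within L arcs, some arc enters the set of those that do,
    -- and its tail reaches s within L + 1 arcs.
    allWithin⊎moreThan : ∀ L → (∀ v → ReachesWithin L v) ⊎ (L < #reachingWithin L)
    allWithin⊎moreThan zero =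
      inj₂ (≤-trans (≤-reflexive (sym (χ-yes (s ≟ s) refl)))
                    (term≤∑ (λ v → χ (reachesWithin? zero v)) s))
    allWithin⊎moreThan (suc L) with all? (reachesWithin? L) | allWithin⊎moreThan L
    ... | yes all   | _        = inj₁ (λ v → inj₁ (all v))
    ... | no notAll | inj₁ all = contradiction all notAll
    ... | no notAll | inj₂ L<# = inj₂ (≤-trans (s≤s L<#) (∑-mono-< grows a newlyReached))
      where
      grows : ∀ v → χ (reachesWithin? L v) ≤ χ (reachesWithin? (suc L) v)
      grows v = χ-mono (reachesWithin? L v) (reachesWithin? (suc L) v) inj₁
      entry = arcLeaving (∁? (reachesWithin? L)) (proj₂ (¬∀⟶∃¬ _ _ (reachesWithin? L) notAll))
                         (λ ¬sink → ¬sink (reachesWithin-sink L))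
      a = proj₁ entry
      newlyReached : χ (reachesWithin? L a) < χ (reachesWithin? (suc L) a)
      newlyReached with _ , ¬Ra , ¬¬Rb , arc ← proj₂ entry =
        subst₂ _<_ (sym (χ-no (reachesWithin? L a) ¬Ra))
                   (sym (χ-yes (reachesWithin? (suc L) a)
                               (inj₂ (_ , arc , decidable-stable (reachesWithin? L _) ¬¬Rb))))
                   (s≤s z≤n)

    stronglyConnected : ∀ v → Star (Arc G) v s
    stronglyConnected v with allWithin⊎moreThan (n G)
    ... | inj₁ all = reachesWithin⇒path (n G) (all v)
    ... | inj₂ n<# = contradiction
      (≤-trans (∑-mono-≤ (λ v → χ≤1 (reachesWithin? (n G) v))) (≤-reflexive ∑-one)) (<⇒≱ n<#)

  totalFiringBound : V G → (V G → ℕ) → ℕ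
  totalFiringBound s x = ∑[ v < n G ] pathFiringBound G (sum x) (stronglyConnected s v)

  stabilize : ∀ s x → ∃ λ y → Stab G s x y
  stabilize s x with stabilizes-or-fires G s (suc (totalFiringBound s x)) x
  ... | inj₁ stabilized = stabilized
  ... | inj₂ (_ , p , bound<firings) = contradiction
    (∑-mono-≤ λ v → firings≤pathFiringBound G p (stronglyConnected s v)) (<⇒≱ bound<firings)

bar-agrees : ∀ G s c i → AgreeOff G s (bar G s c i) c
bar-agrees G s c i v v≢s with v ≟ s
... | yes v≡s = contradiction v≡s v≢s
... | no _    = refl

lemma9 : (G : Digraph) → Eulerian G → (s₁ s₂ : V G) → s₁ ≢ s₂ →
    (c : V G → ℕ) → Recurrent G s₁ c → (i : ℕ) →
    (∃ λ (y : V G → ℕ) → ∃ λ (z : V G → ℕ) →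
        Stab G s₂ (bar G s₁ c i) y × Stab G s₁ y z)
    × (∀ (y z : V G → ℕ) → Stab G s₂ (bar G s₁ c i) y → Stab G s₁ y z →
        ∀ v → z v ≡ bar G s₁ c i v)
lemma9 G eulerian s₁ s₂ _ c c-recurrent i = stabilizations , returnsToStart
  where
  x = bar G s₁ c i
  stabilizations : ∃ λ y → ∃ λ z → Stab G s₂ x y × Stab G s₁ y z
  stabilizations =
    let y , y-stab = stabilize G eulerian s₂ x
        z , z-stab = stabilize G eulerian s₁ y
    in  y , z , y-stab , z-stab
  x-stable : Stable G s₁ x
  x-stable v v≢s₁ =
    subst (_< outdeg G v) (sym (bar-agrees G s₁ c i v v≢s₁)) (proj₁ c-recurrent v v≢s₁)
  returnsToStart : ∀ y z → Stab G s₂ x y → Stab G s₁ y z → ∀ v → z v ≡ x v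
  returnsToStart y z (q₁ , _) (q₂ , z-stable) = uniformFirings⇒unchanged G eulerian p λ u →
    ≤-antisym (stable⇒sinkFiresMost G eulerian x-stable p u)
              (forbiddenFree⇒sinkFiresLeast G eulerian (recurrent⇒forbiddenFree G c-recurrent)
                                            (bar-agrees G s₁ c i) z-stable p u)
    where p = forgetSink G q₁ ◅◅ forgetSink G q₂
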